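{- There exists a family $\{L_n\}_{n\in\mathbb{N}}$ of $\omega$-regular languages such that each $L_n$ is the set of $\omega$-words satisfying an LTL formula of size linear in $n$, whereas every deterministic finite automaton recognizing $(L_n)_\$=\{u\,\$\,v\mid u\,v^\omega\in L_n\}$ has at least $2^{2^n}$ states.
   Context: LTL formulas are interpreted over $\omega$-words over a finite alphabet whose letters are encoded as valuations of atomic propositions; the size of a formula is the size of its syntax tree. For an $\omega$-language $L$ over a finite alphabet $\Sigma$, $(L)_\$$ is the language of finite words $u\,\$\,v$ (with $\$$ a separator symbol, $u,v$ finite words, $v$ nonempty) such that the ultimately periodic $\omega$-word $u\,v^\omega$ belongs to $L$. A DFA is a deterministic finite automaton over finite words. -}

module Defs where

open import Data.Nat using (ℕ; zero; suc; _+_; _*_; _^_; _≤_; _<_)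
open import Data.Bool using (Bool; true)
open import Data.Fin using (Fin)
open import Data.List using (List; []; _∷_; _++_; map; foldl; [_])
open import Data.Product using (Σ; _×_; _,_; ∃)
open import Data.Sum using (_⊎_; inj₁; inj₂)
open import Data.Unit using (⊤; tt)
open import Data.Empty using (⊥)
open import Relation.Nullary using (¬_)
open import Relation.Binary.PropositionalEquality using (_≡_)

Letter : ℕ → Set
Letter k = Fin k → Bool

ωWord : Set → Set
ωWord A = ℕ → A

ωLanguage : Set → Set₁
ωLanguage A = ωWord A → Set

Language : Set → Set₁
Language A = List A → Set

data LTL (k : ℕ) : Set where
  ltrue lfalse : LTL k
  ap    : Fin k → LTL k
  lnot  : LTL k → LTL k
  land lor : LTL k → LTL k → LTL k
  X     : LTL k → LTL k
  _U_   : LTL k → LTL k → LTL k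
  F G   : LTL k → LTL k

size : ∀ {k} → LTL k → ℕ
size ltrue      = 1
size lfalse     = 1
size (ap p)     = 1
size (lnot φ)   = suc (size φ)
size (land φ ψ) = suc (size φ + size ψ)
size (lor φ ψ)  = suc (size φ + size ψ)
size (X φ)      = suc (size φ)
size (φ U ψ)    = suc (size φ + size ψ)
size (F φ)      = suc (size φ)
size (G φ)      = suc (size φ)

suffix : ∀ {A : Set} → ωWord A → ℕ → ωWord A
suffix w j i = w (j + i)

_⊨_ : ∀ {k} → ωWord (Letter k) → LTL k → Set
w ⊨ ltrue      = ⊤
w ⊨ lfalse     = ⊥
w ⊨ ap p       = w 0 p ≡ true
w ⊨ lnot φ     = ¬ (w ⊨ φ)
w ⊨ land φ ψ   = (w ⊨ φ) × (w ⊨ ψ)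
w ⊨ lor φ ψ    = (w ⊨ φ) ⊎ (w ⊨ ψ)
w ⊨ X φ        = suffix w 1 ⊨ φ
w ⊨ (φ U ψ)    = Σ ℕ λ j → (suffix w j ⊨ ψ) × (∀ i → i < j → suffix w i ⊨ φ)
w ⊨ F φ        = Σ ℕ λ j → suffix w j ⊨ φ
w ⊨ G φ        = ∀ j → suffix w j ⊨ φ

⟦_⟧ : ∀ {k} → LTL k → ωLanguage (Letter k)
⟦ φ ⟧ w = w ⊨ φ

-- ultimately periodic words u v^ω  (v = a ∷ vs nonempty)

-- cyc a vs rest i : i-th letter of  rest (a vs)^ω
cyc : ∀ {A : Set} → A → List A → List A → ℕ → A
cyc a vs []       zero    = a
cyc a vs []       (suc i) = cyc a vs vs i
cyc a vs (r ∷ rs) zero    = r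
cyc a vs (r ∷ rs) (suc i) = cyc a vs rs i

lasso : ∀ {A : Set} → List A → A → List A → ωWord A
lasso []      a vs i       = cyc a vs [] i
lasso (x ∷ u) a vs zero    = x
lasso (x ∷ u) a vs (suc i) = lasso u a vs i

$ : ∀ {A : Set} → A ⊎ ⊤
$ = inj₂ tt

Dollar : ∀ {A : Set} → ωLanguage A → Language (A ⊎ ⊤)
Dollar {A} L x =
  Σ (List A) λ u → Σ A λ a → Σ (List A) λ vs →
    (x ≡ map inj₁ u ++ [ $ ] ++ map inj₁ (a ∷ vs)) × L (lasso u a vs)

record DFA (A : Set) : Set where
  field
    states : ℕ
    init   : Fin states
    δ      : Fin states → A → Fin states
    final  : Fin states → Bool

  run : Fin states → List A → Fin states
  run = foldl δ

  Accepts : List A → Set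
  Accepts x = final (run init x) ≡ true

Recognizes : ∀ {A : Set} → DFA A → Language A → Set
Recognizes M L = ∀ x → (DFA.Accepts M x → L x) × (L x → DFA.Accepts M x)

{-# OPTIONS --safe #-}
-- Over the propositions p₀, p₁, …, pₙ the formula F (p₀ ∧ ⋀ₜ (pₜ₊₁ ↔ F G pₜ₊₁)) says that some
-- p₀-marked letter agrees on p₁ … pₙ with the valuation that eventually holds forever.
-- Number the 2ⁿ valuations by Fin (2 ^ n) and the 2^(2ⁿ) sets S of them by Fin (2 ^ 2 ^ n),
-- both through binary digits, and let x_S list the marked letters of S followed by $.
-- Then x_S followed by the unmarked letter of j lies in the $-language iff j ∈ S: the loop
-- fixes the eventual valuation to j, and the marked letters are exactly those of S.
-- Hence distinct sets give Myhill–Nerode-inequivalent prefixes, which a DFA must send to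
-- distinct states.
module Submission where

open import Defs
open import Data.Nat using (ℕ; _+_; _*_; _^_; _≤_)
open import Data.Unit using (⊤)
open import Data.Sum using (_⊎_)
open import Data.Product using (Σ; _×_)

open import Level using (0ℓ)
open import Data.Nat using (zero; suc; s≤s)
open import Data.Nat.Properties using (+-suc; +-identityʳ; +-comm; *-comm; +-mono-≤; ≤-reflexive; ≤-trans; m≤m+n; m≤n+m; module ≤-Reasoning)
open import Data.Bool using (Bool; true; false; _≟_)
open import Data.Bool.Properties using (⇔→≡)
open import Data.Fin using (Fin; zero; suc; finToFun; funToFin; combine)
open import Data.Fin.Properties using (funToFin-finToFin; 2↔Bool; injective⇒≤)
open import Data.List using (List; []; _∷_; _++_; map; [_]; length; filter; allFin)
open import Data.List.Properties using (foldl-++; ++-assoc; map-injective; ∷-injective)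
open import Data.List.Relation.Unary.Any using (Any; here; there)
open import Data.List.Membership.Propositional using (lose; find)
open import Data.List.Membership.Propositional.Properties using (∈-map⁺; ∈-map⁻; ∈-filter⁺; ∈-filter⁻; ∈-allFin)
open import Data.Product using (_,_; proj₁; proj₂; ∃)
open import Data.Sum using (inj₁; inj₂)
open import Data.Sum.Properties using (inj₁-injective)
open import Data.Unit using (tt)
open import Data.Empty using (⊥-elim)
open import Function using (_∘_; const; _⇔_; mk⇔; Equivalence; Inverse; Injection)
open import Function.Properties.Inverse using (↔⇒↣)
import Function.Properties.Equivalence as ⇔
open import Relation.Nullary using (¬_; Dec; yes; no)
open import Relation.Binary.PropositionalEquality using (_≡_; refl; sym; trans; cong; cong₂; subst; _≗_; module ≡-Reasoning)
import Relation.Binary.Reasoning.Setoid as SetoidReasoning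

funToFin-cong : ∀ {m n} {f g : Fin m → Fin n} → f ≗ g → funToFin f ≡ funToFin g
funToFin-cong {zero}  f≗g = refl
funToFin-cong {suc m} f≗g = cong₂ combine (f≗g zero) (funToFin-cong (f≗g ∘ suc))

finToFun-injective : ∀ {m n} {x y : Fin (m ^ n)} → finToFun {m} {n} x ≗ finToFun y → x ≡ y
finToFun-injective {m} {n} {x} {y} x≗y = begin
  x                             ≡⟨ sym (funToFin-finToFin {n} {m} x) ⟩
  funToFin (finToFun {m} {n} x) ≡⟨ funToFin-cong x≗y ⟩
  funToFin (finToFun {m} {n} y) ≡⟨ funToFin-finToFin {n} {m} y ⟩
  y                             ∎
  where open ≡-Reasoning

bits : ∀ {k} → Fin (2 ^ k) → Fin k → Bool
bits {k} x = Inverse.to 2↔Bool ∘ finToFun {2} {k} x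

bits-injective : ∀ {k} {x y : Fin (2 ^ k)} → bits x ≗ bits y → x ≡ y
bits-injective {k} x≗y = finToFun-injective {2} {k} (Injection.injective (↔⇒↣ 2↔Bool) ∘ x≗y)

iff : ∀ {k} → LTL k → LTL k → LTL k
iff φ ψ = lor (land φ ψ) (land (lnot φ) (lnot ψ))

⋀ : ∀ {k m} → (Fin m → LTL k) → LTL k
⋀ {m = zero}  ψ = ltrue
⋀ {m = suc m} ψ = land (ψ zero) (⋀ (ψ ∘ suc))

⊨-iff : ∀ {k} {w : ωWord (Letter k)} {φ ψ} → Dec (w ⊨ φ) → w ⊨ iff φ ψ ⇔ (w ⊨ φ ⇔ w ⊨ ψ)
⊨-iff {w = w} {φ} {ψ} w⊨φ? = mk⇔ to (from w⊨φ?)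
  where
  to : w ⊨ iff φ ψ → (w ⊨ φ ⇔ w ⊨ ψ)
  to (inj₁ (w⊨φ , w⊨ψ)) = mk⇔ (const w⊨ψ) (const w⊨φ)
  to (inj₂ (w⊭φ , w⊭ψ)) = mk⇔ (⊥-elim ∘ w⊭φ) (⊥-elim ∘ w⊭ψ)
  from : Dec (w ⊨ φ) → (w ⊨ φ ⇔ w ⊨ ψ) → w ⊨ iff φ ψ
  from (yes w⊨φ) φ⇔ψ = inj₁ (w⊨φ , Equivalence.to φ⇔ψ w⊨φ)
  from (no w⊭φ)  φ⇔ψ = inj₂ (w⊭φ , w⊭φ ∘ Equivalence.from φ⇔ψ)

⊨-⋀ : ∀ {k m} {w : ωWord (Letter k)} (ψ : Fin m → LTL k) → w ⊨ ⋀ ψ ⇔ (∀ t → w ⊨ ψ t)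
⊨-⋀ {m = zero}  ψ = mk⇔ (λ _ ()) (const tt)
⊨-⋀ {m = suc m} {w} ψ = mk⇔ to from
  where
  to : w ⊨ ⋀ ψ → ∀ t → w ⊨ ψ t
  to (w⊨ψ₀ , _)  zero    = w⊨ψ₀
  to (_ , w⊨⋀ψₛ) (suc t) = Equivalence.to (⊨-⋀ (ψ ∘ suc)) w⊨⋀ψₛ t
  from : (∀ t → w ⊨ ψ t) → w ⊨ ⋀ ψ
  from w⊨ψ = w⊨ψ zero , Equivalence.from (⊨-⋀ (ψ ∘ suc)) (w⊨ψ ∘ suc)

size-⋀ : ∀ {k m s} (ψ : Fin m → LTL k) → (∀ t → size (ψ t) ≡ s) → size (⋀ ψ) ≡ suc (m * suc s)
size-⋀ {m = zero}      ψ _      = refl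
size-⋀ {m = suc m} {s} ψ size≡s = begin
  suc (size (ψ zero) + size (⋀ (ψ ∘ suc)))
    ≡⟨ cong₂ (λ a b → suc (a + b)) (size≡s zero) (size-⋀ (ψ ∘ suc) (size≡s ∘ suc)) ⟩
  suc (s + suc (m * suc s))                 ≡⟨ cong suc (+-suc s (m * suc s)) ⟩
  suc (suc m * suc s)                       ∎
  where open ≡-Reasoning

module _ {A : Set} where

  cyc-const : ∀ (b : A) i → cyc b [] [] i ≡ b
  cyc-const b zero    = refl
  cyc-const b (suc i) = cyc-const b i

  lasso-const : ∀ (u : List A) b {i} → length u ≤ i → lasso u b [] i ≡ b
  lasso-const []      b {i}     _           = cyc-const b i
  lasso-const (x ∷ u) b {suc i} (s≤s |u|≤i) = lasso-const u b |u|≤i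

  ∃-lasso⇔Any : ∀ {p} {P : A → Set p} (u : List A) {b} → ¬ P b →
                (∃ λ i → P (lasso u b [] i)) ⇔ Any P u
  ∃-lasso⇔Any {P = P} [] ¬Pb = mk⇔ (λ (i , Pbᵢ) → ⊥-elim (¬Pb (subst P (cyc-const _ i) Pbᵢ))) λ ()
  ∃-lasso⇔Any {P = P} (x ∷ u) {b} ¬Pb = mk⇔ to from
    where
    IH : (∃ λ i → P (lasso u b [] i)) ⇔ Any P u
    IH = ∃-lasso⇔Any u ¬Pb
    to : (∃ λ i → P (lasso (x ∷ u) b [] i)) → Any P (x ∷ u)
    to (zero  , Px)  = here Px
    to (suc i , Pwᵢ) = there (Equivalence.to IH (i , Pwᵢ))
    from : Any P (x ∷ u) → ∃ λ i → P (lasso (x ∷ u) b [] i)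
    from (here Px)  = zero , Px
    from (there Pu) = let i , Pwᵢ = Equivalence.from IH Pu in suc i , Pwᵢ

matchesLimit : (n : ℕ) → LTL (suc n)
matchesLimit n = ⋀ λ t → iff (ap (suc t)) (F (G (ap (suc t))))

markedMatchesLimit : (n : ℕ) → LTL (suc n)
markedMatchesLimit n = F (land (ap zero) (matchesLimit n))

size-markedMatchesLimit : ∀ n → size (markedMatchesLimit n) ≤ 14 * n + 14
size-markedMatchesLimit n = begin
  size (markedMatchesLimit n) ≡⟨ cong (3 +_) (size-⋀ {s = 13} _ (λ _ → refl)) ⟩
  4 + n * 14                  ≡⟨ +-comm 4 (n * 14) ⟩
  n * 14 + 4                  ≤⟨ +-mono-≤ (≤-reflexive (*-comm n 14)) (m≤m+n 4 10) ⟩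
  14 * n + 14                 ∎
  where open ≤-Reasoning

module _ {k : ℕ} (u : List (Letter k)) (b : Letter k) where

  private
    w : ωWord (Letter k)
    w = lasso u b []

  ⊨-FG-lasso : ∀ i p → suffix w i ⊨ F (G (ap p)) ⇔ b p ≡ true
  ⊨-FG-lasso i p = mk⇔ to from
    where
    wⱼ≡b : ∀ {j} → length u ≤ j → w j p ≡ b p
    wⱼ≡b |u|≤j = cong (λ a → a p) (lasso-const u b |u|≤j)
    to : suffix w i ⊨ F (G (ap p)) → b p ≡ true
    to (j , always) =
      trans (sym (wⱼ≡b (≤-trans (m≤m+n _ 0) (≤-trans (m≤n+m _ j) (m≤n+m _ i))))) (always (length u))
    from : b p ≡ true → suffix w i ⊨ F (G (ap p))
    from bₚ = length u , λ j → trans (wⱼ≡b (≤-trans (m≤m+n _ (j + 0)) (m≤n+m _ i))) bₚ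

  ⊨-iffFG-lasso : ∀ i p → suffix w i ⊨ iff (ap p) (F (G (ap p))) ⇔ w (i + 0) p ≡ b p
  ⊨-iffFG-lasso i p = mk⇔ to from
    where
    ⊨-iff-here : suffix w i ⊨ iff (ap p) (F (G (ap p)))
               ⇔ (w (i + 0) p ≡ true ⇔ suffix w i ⊨ F (G (ap p)))
    ⊨-iff-here = ⊨-iff {w = suffix w i} {ap p} {F (G (ap p))} (w (i + 0) p ≟ true)
    to : suffix w i ⊨ iff (ap p) (F (G (ap p))) → w (i + 0) p ≡ b p
    to h = ⇔→≡ (⇔.trans (Equivalence.to ⊨-iff-here h) (⊨-FG-lasso i p))
    from : w (i + 0) p ≡ b p → suffix w i ⊨ iff (ap p) (F (G (ap p)))
    from eq = Equivalence.from ⊨-iff-here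
      (⇔.trans (mk⇔ (trans (sym eq)) (trans eq)) (⇔.sym (⊨-FG-lasso i p)))

_IsMarkedCopyOf_ : ∀ {n} → Letter (suc n) → Letter (suc n) → Set
a IsMarkedCopyOf b = a zero ≡ true × (∀ t → a (suc t) ≡ b (suc t))

module _ {n : ℕ} (u : List (Letter (suc n))) (b : Letter (suc n)) where

  private
    w : ωWord (Letter (suc n))
    w = lasso u b []

  ⊨-matchesLimit-lasso : ∀ i → suffix w i ⊨ matchesLimit n ⇔ (∀ t → w (i + 0) (suc t) ≡ b (suc t))
  ⊨-matchesLimit-lasso i = mk⇔
    (λ h t → Equivalence.to (⊨-iffFG-lasso u b i (suc t)) (Equivalence.to (⊨-⋀ _) h t))
    (λ h → Equivalence.from (⊨-⋀ _) λ t → Equivalence.from (⊨-iffFG-lasso u b i (suc t)) (h t))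

  ⊨-markedMatchesLimit-lasso : b zero ≡ false → w ⊨ markedMatchesLimit n ⇔ Any (_IsMarkedCopyOf b) u
  ⊨-markedMatchesLimit-lasso b₀≡false = ⇔.trans (mk⇔ to from) (∃-lasso⇔Any u b-unmarked)
    where
    b-unmarked : ¬ (b IsMarkedCopyOf b)
    b-unmarked (b₀≡true , _) with () ← trans (sym b₀≡false) b₀≡true
    wᵢ≡wᵢ₊₀ : ∀ i → w i ≡ w (i + 0)
    wᵢ≡wᵢ₊₀ i = cong w (sym (+-identityʳ i))
    to : w ⊨ markedMatchesLimit n → ∃ λ i → w i IsMarkedCopyOf b
    to (i , marked , matches) =
      i , subst (_IsMarkedCopyOf b) (sym (wᵢ≡wᵢ₊₀ i))
              (marked , Equivalence.to (⊨-matchesLimit-lasso i) matches)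
    from : (∃ λ i → w i IsMarkedCopyOf b) → w ⊨ markedMatchesLimit n
    from (i , copy) with marked , matches ← subst (_IsMarkedCopyOf b) (wᵢ≡wᵢ₊₀ i) copy =
      i , marked , Equivalence.from (⊨-matchesLimit-lasso i) matches

marked unmarked : ∀ {n} → Fin (2 ^ n) → Letter (suc n)
marked   j zero    = true
marked   j (suc t) = bits j t
unmarked j zero    = false
unmarked j (suc t) = bits j t

markedListing : ∀ {n} → (Fin (2 ^ n) → Bool) → List (Letter (suc n))
markedListing S = map marked (filter (λ i → S i ≟ true) (allFin _))

Any-IsMarkedCopyOf-markedListing : ∀ {n} (S : Fin (2 ^ n) → Bool) j →
  Any (_IsMarkedCopyOf unmarked j) (markedListing S) ⇔ S j ≡ true
Any-IsMarkedCopyOf-markedListing {n} S j = mk⇔ to from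
  where
  S? : ∀ i → Dec (S i ≡ true)
  S? i = S i ≟ true
  to : Any (_IsMarkedCopyOf unmarked j) (markedListing S) → S j ≡ true
  to copy with find {P = _IsMarkedCopyOf unmarked j} copy
  ... | _ , a∈ , _ , same-bits with ∈-map⁻ marked a∈
  ... | j′ , j′∈ , refl with bits-injective {n} {j′} {j} same-bits
  ... | refl = proj₂ (∈-filter⁻ S? {xs = allFin _} j′∈)
  from : S j ≡ true → Any (_IsMarkedCopyOf unmarked j) (markedListing S)
  from Sj = lose (∈-map⁺ marked (∈-filter⁺ S? (∈-allFin j) Sj)) (refl , λ _ → refl)

module _ {C : Set} where

  $-split-injective : ∀ (u u′ : List C) {r r′} →
                      map inj₁ u ++ $ ∷ r ≡ map inj₁ u′ ++ $ ∷ r′ → u ≡ u′ × r ≡ r′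
  $-split-injective []      []       refl = refl , refl
  $-split-injective (x ∷ u) (x′ ∷ u′) eq with x≡x′ , rest ← ∷-injective eq
    with u≡u′ , r≡r′ ← $-split-injective u u′ rest = cong₂ _∷_ (inj₁-injective x≡x′) u≡u′ , r≡r′

  Dollar-lasso : ∀ {L : ωLanguage C} u a vs →
                 Dollar L (map inj₁ u ++ $ ∷ map inj₁ (a ∷ vs)) ⇔ L (lasso u a vs)
  Dollar-lasso {L} u a vs = mk⇔ to (λ h → u , a , vs , refl , h)
    where
    to : Dollar L (map inj₁ u ++ $ ∷ map inj₁ (a ∷ vs)) → L (lasso u a vs)
    to (u′ , a′ , vs′ , eq , h) with refl , r≡r′ ← $-split-injective u u′ eq
      with refl ← map-injective inj₁-injective r≡r′ = h

NerodeEquivalent : ∀ {A : Set} → Language A → List A → List A → Set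
NerodeEquivalent L x y = ∀ z → L (x ++ z) ⇔ L (y ++ z)

module _ {A : Set} (M : DFA A) where
  open DFA M

  sameRun-++ : ∀ x y z → run init x ≡ run init y → run init (x ++ z) ≡ run init (y ++ z)
  sameRun-++ x y z eq = begin
    run init (x ++ z)   ≡⟨ foldl-++ δ init x z ⟩
    run (run init x) z  ≡⟨ cong (λ q → run q z) eq ⟩
    run (run init y) z  ≡⟨ foldl-++ δ init y z ⟨
    run init (y ++ z)   ∎
    where open ≡-Reasoning

  sameRun⇒NerodeEquivalent : ∀ {L} → Recognizes M L →
                             ∀ x y → run init x ≡ run init y → NerodeEquivalent L x y
  sameRun⇒NerodeEquivalent {L} M↔L x y eq z = mk⇔ (transfer eq) (transfer (sym eq))
    where
    transfer : ∀ {x y} → run init x ≡ run init y → L (x ++ z) → L (y ++ z)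
    transfer {x} {y} eq Lxz =
      proj₁ (M↔L (y ++ z))
        (subst (λ q → final q ≡ true) (sameRun-++ x y z eq) (proj₂ (M↔L (x ++ z)) Lxz))

  nerodeInjective⇒≤states : ∀ {L N} → Recognizes M L → (x : Fin N → List A) →
                            (∀ {i j} → NerodeEquivalent L (x i) (x j) → i ≡ j) → N ≤ states
  nerodeInjective⇒≤states M↔L x x-injective = injective⇒≤ {f = λ i → run init (x i)}
    λ {i} {j} → x-injective ∘ sameRun⇒NerodeEquivalent M↔L (x i) (x j)

prefix : ∀ n → Fin (2 ^ (2 ^ n)) → List (Letter (suc n) ⊎ ⊤)
prefix n m = map inj₁ (markedListing (bits m)) ++ [ $ ]

Dollar-prefix : ∀ n m j →
                Dollar ⟦ markedMatchesLimit n ⟧ (prefix n m ++ [ inj₁ (unmarked j) ]) ⇔ bits m j ≡ true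
Dollar-prefix n m j = begin
  Dollar L (prefix n m ++ [ inj₁ (unmarked j) ])        ≡⟨ cong (Dollar L) (++-assoc (map inj₁ u) [ $ ] _) ⟩
  Dollar L (map inj₁ u ++ $ ∷ map inj₁ [ unmarked j ]) ≈⟨ Dollar-lasso {L = L} u (unmarked j) [] ⟩
  lasso u (unmarked j) [] ⊨ markedMatchesLimit n        ≈⟨ ⊨-markedMatchesLimit-lasso u (unmarked j) refl ⟩
  Any (_IsMarkedCopyOf unmarked j) u                    ≈⟨ Any-IsMarkedCopyOf-markedListing (bits m) j ⟩
  bits m j ≡ true                                       ∎
  where
  open SetoidReasoning (⇔.⇔-setoid 0ℓ)
  u : List (Letter (suc n))
  u = markedListing (bits m)
  L : ωLanguage (Letter (suc n))
  L = ⟦ markedMatchesLimit n ⟧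

prefix-nerodeInjective : ∀ n {m m′} →
  NerodeEquivalent (Dollar ⟦ markedMatchesLimit n ⟧) (prefix n m) (prefix n m′) → m ≡ m′
prefix-nerodeInjective n {m} {m′} m~m′ = bits-injective λ j →
  ⇔→≡ (⇔.trans (⇔.sym (Dollar-prefix n m j)) (⇔.trans (m~m′ _) (Dollar-prefix n m′ j)))

proposition34 : Σ (ℕ → ℕ) λ k → Σ ((n : ℕ) → LTL (k n)) λ φ → Σ ℕ λ c →
    ((n : ℕ) → size (φ n) ≤ c * n + c)
    × ((n : ℕ) → (M : DFA (Letter (k n) ⊎ ⊤)) →
         Recognizes M (Dollar ⟦ φ n ⟧) → 2 ^ (2 ^ n) ≤ DFA.states M)
proposition34 = suc , markedMatchesLimit , 14 , size-markedMatchesLimit ,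
  λ n M M↔L → nerodeInjective⇒≤states M M↔L (prefix n) (prefix-nerodeInjective n)
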